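{- Let $D$ be an $n\times n$ distance matrix and $i,j\in[n]$ with $D_{ij}=3$ and $D^{(2)}_{ij}>3$, where $D^{(2)}$ is the distance matrix of the $2$-skeleton of $D$. Let $(G=(V,E),\Phi)$ be a graph realisation of $D$ with $V=\{v_i=\Phi(i):i\in[n]\}\cup\{v_{n+1},v_{n+2}\}$, where $v_{n+1},v_{n+2}\notin\Phi([n])$ are distinct. Then every shortest path from $v_i$ to $v_j$ in $G$ is of the form $v_i\to v_{n+1}\to v_{n+2}\to v_j$ or $v_i\to v_{n+2}\to v_{n+1}\to v_j$.
   Context: $[n]=\{1,\dots,n\}$. An $n\times n$ matrix $D$ with non-negative integer entries is a distance matrix if all diagonal entries are $0$, all off-diagonal entries are strictly positive, $D$ is symmetric, and $D_{iw}+D_{wj}\ge D_{ij}$ for all $i,j,w$. A graph realisation of $D$ is a pair $(G,\Phi)$ with $G=(V,E)$ a finite simple undirected unweighted graph and $\Phi:[n]\to V$ injective such that $d_G(\Phi(i),\Phi(j))=D_{ij}$ for all $i,j$ ($d_G$ the shortest-path distance). The $2$-skeleton of $D$ is the edge-weighted graph on $[n]$ with an edge $\{i,j\}$ ($i<j$) iff $D_{ij}\le2$, of weight $D_{ij}$; $D^{(2)}_{ij}$ is the weighted shortest-path distance from $i$ to $j$ in it ($\infty$ if none). -}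

module Defs where

open import Level using (0ℓ)
open import Data.Nat using (ℕ; zero; suc; _+_; _≤_; _<_)
open import Data.Fin using (Fin)
open import Data.List using (List; []; _∷_)
open import Data.Product using (Σ; _×_; _,_)
open import Relation.Binary.PropositionalEquality using (_≡_; _≢_)
open import Relation.Nullary using (¬_)
open import Function.Definitions using (Injective)

Matrix : ℕ → Set
Matrix n = Fin n → Fin n → ℕ

record IsDistanceMatrix {n : ℕ} (D : Matrix n) : Set where
  field
    diag     : ∀ i → D i i ≡ 0
    offdiag  : ∀ i j → i ≢ j → 0 < D i j
    symmetric : ∀ i j → D i j ≡ D j i
    triangle : ∀ i j w → D i j ≤ D i w + D w j

record Graph : Set₁ where
  field
    m      : ℕ
    E      : Fin m → Fin m → Set
    E-sym  : ∀ {u v} → E u v → E v u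
    E-irr  : ∀ {u} → ¬ E u u

  V : Set
  V = Fin m

  data Walk : V → V → ℕ → Set where
    stop : (u : V) → Walk u u 0
    step : (u : V) {v w : V} {k : ℕ} → E u v → Walk v w k → Walk u w (suc k)

  vertices : ∀ {u v k} → Walk u v k → List V
  vertices (stop u)     = u ∷ []
  vertices (step u _ p) = u ∷ vertices p

  Dist : V → V → ℕ → Set
  Dist u v k = Walk u v k × (∀ l → Walk u v l → k ≤ l)

record IsRealisation {n : ℕ} (D : Matrix n) (G : Graph) (Φ : Fin n → Graph.V G) : Set where
  field
    injective : Injective _≡_ _≡_ Φ
    distances : ∀ i j → Graph.Dist G (Φ i) (Φ j) (D i j)

-- Walks in the 2-skeleton of D, indexed by total weight:
-- edges {i,k} with i ≠ k and D i k ≤ 2, of weight D i k.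
data SkWalk {n : ℕ} (D : Matrix n) : Fin n → Fin n → ℕ → Set where
  stop : ∀ i → SkWalk D i i 0
  step : ∀ i {k j w} → i ≢ k → D i k ≤ 2 → SkWalk D k j w → SkWalk D i j (D i k + w)

-- D⁽²⁾ i j > c  (with D⁽²⁾ i j = ∞ when no skeleton path exists):
-- every skeleton walk from i to j has weight > c.
D2-greater : {n : ℕ} → Matrix n → Fin n → Fin n → ℕ → Set
D2-greater D i j c = ∀ w → SkWalk D i j w → c < w

{-# OPTIONS --safe #-}
module Submission where

-- An interior vertex Φ k of a shortest walk of length 3 from Φ i to Φ j would split it into
-- pieces of lengths 1 and 2, so D i k + D k j ≤ 3 with both terms at most 2, and i → k → j
-- would be a skeleton path of weight at most 3. Hence both interior vertices are extra
-- vertices, and being adjacent they are distinct.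

open import Defs
open import Data.Nat using (ℕ; _≤_; _<_; _+_; s≤s; z≤n)
open import Data.Nat.Properties
  using (≤-antisym; ≤-trans; ≤-refl; +-identityʳ; +-mono-≤; <⇒≱; <-irrefl)
open import Data.Fin using (Fin)
open import Data.List using ([]; _∷_)
open import Data.Product using (Σ; ∃₂; _×_; _,_; proj₂)
open import Data.Sum using (_⊎_; inj₁; inj₂)
open import Data.Empty using (⊥-elim)
open import Relation.Binary.PropositionalEquality using (_≡_; _≢_; refl; sym; trans; cong; subst)

module _ (G : Graph) where
  open Graph G

  shortest-walk-length : ∀ {u v d k} → Dist u v d → Walk u v k →
                         (∀ l → Walk u v l → k ≤ l) → k ≡ d
  shortest-walk-length (p , p-min) q q-min = ≤-antisym (q-min _ p) (p-min _ q)

  walk-length-three : ∀ {u v} (p : Walk u v 3) →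
    ∃₂ λ x y → E u x × E x y × E y v × vertices p ≡ u ∷ x ∷ y ∷ v ∷ []
  walk-length-three (step _ e₁ (step _ e₂ (step _ e₃ (stop _)))) = _ , _ , e₁ , e₂ , e₃ , refl

D2-greater-split : ∀ {n} {D : Matrix n} {i j k c} → D2-greater D i j c → 2 < D i j →
                   D i k ≤ 2 → D k j ≤ 2 → c < D i k + D k j
D2-greater-split {D = D} {i} {j} {k} {c} d2 2<Dij Dik≤2 Dkj≤2 =
  subst (c <_) (cong (D i k +_) (+-identityʳ (D k j)))
        (d2 _ (step i i≢k Dik≤2 (step k k≢j Dkj≤2 (stop j))))
  where
  i≢k : i ≢ k
  i≢k refl = <⇒≱ 2<Dij Dkj≤2
  k≢j : k ≢ j
  k≢j refl = <⇒≱ 2<Dij Dik≤2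

module _ {n} {D : Matrix n} {G : Graph} {Φ : Fin n → Graph.V G}
         (re : IsRealisation D G Φ) where
  open Graph G
  open IsRealisation re

  walk-length-bound : ∀ {u v l} → Walk (Φ u) (Φ v) l → D u v ≤ l
  walk-length-bound p = proj₂ (distances _ _) _ p

  realised-split : ∀ {i j k c l₁ l₂} → D2-greater D i j c → 2 < D i j →
                   Walk (Φ i) (Φ k) l₁ → Walk (Φ k) (Φ j) l₂ → l₁ ≤ 2 → l₂ ≤ 2 →
                   c < l₁ + l₂
  realised-split {i} {j} {k} {l₁ = l₁} {l₂} d2 2<Dij p q l₁≤2 l₂≤2 =
    ≤-trans (D2-greater-split d2 2<Dij (≤-trans Dik≤l₁ l₁≤2) (≤-trans Dkj≤l₂ l₂≤2))
            (+-mono-≤ Dik≤l₁ Dkj≤l₂)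
    where
    Dik≤l₁ : D i k ≤ l₁
    Dik≤l₁ = walk-length-bound p
    Dkj≤l₂ : D k j ≤ l₂
    Dkj≤l₂ = walk-length-bound q

  module _ {i j} (Dij≡3 : D i j ≡ 3) (d2 : D2-greater D i j 3) where

    2<Dij : 2 < D i j
    2<Dij = subst (2 <_) (sym Dij≡3) ≤-refl

    interior-vertices-unrealised : ∀ {x y} → E (Φ i) x → E x y → E y (Φ j) →
                                   (∀ k → Φ k ≢ x) × (∀ k → Φ k ≢ y)
    interior-vertices-unrealised e₁ e₂ e₃ =
        (λ { k refl → <-irrefl refl (split (one e₁) (two e₂ e₃) (s≤s z≤n) ≤-refl) })
      , (λ { k refl → <-irrefl refl (split (two e₁ e₂) (one e₃) ≤-refl (s≤s z≤n)) })
      where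
      split : ∀ {k l₁ l₂} → Walk (Φ i) (Φ k) l₁ → Walk (Φ k) (Φ j) l₂ →
              l₁ ≤ 2 → l₂ ≤ 2 → 3 < l₁ + l₂
      split = realised-split d2 2<Dij
      one : ∀ {u v} → E u v → Walk u v 1
      one e = step _ e (stop _)
      two : ∀ {u v w} → E u v → E v w → Walk u w 2
      two e e′ = step _ e (one e′)

outside-image : ∀ {A B : Set} {Φ : A → B} {a b v : B} →
                (∀ v → (Σ A λ k → Φ k ≡ v) ⊎ (v ≡ a ⊎ v ≡ b)) → (∀ k → Φ k ≢ v) →
                v ≡ a ⊎ v ≡ b
outside-image {v = v} cover unrealised with cover v
... | inj₁ (k , Φk≡v) = ⊥-elim (unrealised k Φk≡v)
... | inj₂ v≡a⊎v≡b = v≡a⊎v≡b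

distinct-pair : ∀ {A : Set} {a b x y : A} → x ≡ a ⊎ x ≡ b → y ≡ a ⊎ y ≡ b → x ≢ y →
                (x ≡ a × y ≡ b) ⊎ (x ≡ b × y ≡ a)
distinct-pair (inj₁ refl) (inj₁ refl) x≢y = ⊥-elim (x≢y refl)
distinct-pair (inj₁ x≡a) (inj₂ y≡b) _ = inj₁ (x≡a , y≡b)
distinct-pair (inj₂ x≡b) (inj₁ y≡a) _ = inj₂ (x≡b , y≡a)
distinct-pair (inj₂ refl) (inj₂ refl) x≢y = ⊥-elim (x≢y refl)

lemma5 : (n : ℕ) (D : Matrix n) → IsDistanceMatrix D →
         (i j : Fin n) → D i j ≡ 3 → D2-greater D i j 3 →
         (G : Graph) (Φ : Fin n → Graph.V G) → IsRealisation D G Φ →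
         (a b : Graph.V G) → a ≢ b →
         (∀ k → Φ k ≢ a) → (∀ k → Φ k ≢ b) →
         (∀ v → (Σ (Fin n) λ k → Φ k ≡ v) ⊎ (v ≡ a ⊎ v ≡ b)) →
         (k : ℕ) (p : Graph.Walk G (Φ i) (Φ j) k) →
         (∀ l → Graph.Walk G (Φ i) (Φ j) l → k ≤ l) →
         (Graph.vertices G p ≡ Φ i ∷ a ∷ b ∷ Φ j ∷ [])
           ⊎ (Graph.vertices G p ≡ Φ i ∷ b ∷ a ∷ Φ j ∷ [])
lemma5 _ _ _ i j Dij≡3 d2 G Φ re a b _ _ _ cover _ p p-min
  with trans (shortest-walk-length G (IsRealisation.distances re i j) p p-min) Dij≡3
... | refl with walk-length-three G p
...   | x , y , e₁ , e₂ , e₃ , vertices≡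
  with interior-vertices-unrealised re Dij≡3 d2 e₁ e₂ e₃
...     | x-unrealised , y-unrealised
  with distinct-pair (outside-image cover x-unrealised) (outside-image cover y-unrealised)
                     (λ { refl → Graph.E-irr G e₂ })
...       | inj₁ (refl , refl) = inj₁ vertices≡
...       | inj₂ (refl , refl) = inj₂ vertices≡
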